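{- Let $G,H$ be graphs. Suppose that in the first two rounds of $\mathrm{EHR}^{\mathrm{MSO}}(G,H,3)$ a vertex $x$ and a set $X$ were chosen in $G$, and a vertex $y$ and a set $Y$ were chosen in $H$ (regardless of who chose what and in which order, with $x,y$ chosen in the same round and $X,Y$ chosen in the same round). If $(x,X)$ is equivalent to $(y,Y)$, then Duplicator has a strategy that wins in the last round.
   Context: The game $\mathrm{EHR}^{\mathrm{MSO}}(A,B,k)$ is played by Spoiler and Duplicator on graphs $A,B$ for $k$ rounds. In each round Spoiler picks one of the graphs and either a vertex or a subset of its vertex set; Duplicator responds with a vertex (resp. a subset) of the other graph. At the end Duplicator wins iff for all pairs of rounds $i,j$ in which vertices were chosen, $x_i\sim x_j\Leftrightarrow y_i\sim y_j$ and $x_i=x_j\Leftrightarrow y_i=y_j$, and for every vertex round $i$ and set round $j$, $x_i\in X_j\Leftrightarrow y_i\in Y_j$ (where $x_i,X_j$ are the choices in $A$ and $y_i,Y_j$ the choices in $B$). For $X\subseteq V(G)$, $\bar X=V(G)\setminus X$. For a set $Z\subseteq V(G)$ and $v\in Z$: $v$ is $Z$-inside-dominating if adjacent to all vertices of $Z\setminus\{v\}$, $Z$-inside-isolated if adjacent to no vertex of $Z$, $Z$-inside-common otherwise; $v$ is $Z$-outside-dominating if adjacent to all vertices of $V(G)\setminus Z$, $Z$-outside-isolated if adjacent to none of them, $Z$-outside-common otherwise; the type of $v$ is its (inside property, outside property) pair. The type of a vertex $x$ with respect to $X$ means its type with respect to whichever of $X,\bar X$ contains $x$. The pair $(x,X)$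 is equivalent to $(y,Y)$ if $x\in X\Leftrightarrow y\in Y$ and the type of $x$ w.r.t. $X$ equals the type of $y$ w.r.t. $Y$. -}

module Defs where

open import Data.Nat using (ℕ)
open import Data.Bool using (Bool; true; false)
open import Data.Fin using (Fin)
open import Data.Fin.Subset using (Subset; _∈_; _∉_; ∁)
open import Data.Product using (_×_; ∃)
open import Data.Unit using (⊤)
open import Data.List using (List; []; _∷_; _++_)
open import Data.List.Membership.Propositional using () renaming (_∈_ to _∈ₗ_)
open import Function.Bundles using (_⇔_)
open import Relation.Binary.PropositionalEquality using (_≡_; _≢_)
open import Relation.Nullary using (¬_; yes; no)
open import Data.Fin.Subset.Properties using (_∈?_)

record Graph : Set where
  field
    order  : ℕ
    adj    : Fin order → Fin order → Bool
    sym    : ∀ u v → adj u v ≡ adj v u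
    irrefl : ∀ v → adj v v ≡ false

open Graph public

V : Graph → Set
V G = Fin (order G)

VSet : Graph → Set
VSet G = Subset (order G)

_∼_ : {G : Graph} → V G → V G → Set
_∼_ {G} u v = adj G u v ≡ true

-- Vertex types with respect to a set Z (v ∈ Z assumed by usage)

InsideDominating : (G : Graph) → VSet G → V G → Set
InsideDominating G Z v = ∀ w → w ∈ Z → w ≢ v → _∼_ {G} v w

InsideIsolated : (G : Graph) → VSet G → V G → Set
InsideIsolated G Z v = ∀ w → w ∈ Z → ¬ (_∼_ {G} v w)

OutsideDominating : (G : Graph) → VSet G → V G → Set
OutsideDominating G Z v = ∀ w → w ∉ Z → _∼_ {G} v w

OutsideIsolated : (G : Graph) → VSet G → V G → Set
OutsideIsolated G Z v = ∀ w → w ∉ Z → ¬ (_∼_ {G} v w)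

-- "common" = neither dominating nor isolated, so the type of v w.r.t. Z
-- is determined by the four predicates above; two vertices have the same
-- type iff they agree on each of these predicates.
SameTypeWrt : (G H : Graph) → VSet G → V G → VSet H → V H → Set
SameTypeWrt G H Z x W y =
  (InsideDominating G Z x ⇔ InsideDominating H W y) ×
  (InsideIsolated G Z x ⇔ InsideIsolated H W y) ×
  (OutsideDominating G Z x ⇔ OutsideDominating H W y) ×
  (OutsideIsolated G Z x ⇔ OutsideIsolated H W y)

partOf : (G : Graph) → V G → VSet G → VSet G
partOf G x X with x ∈? X
... | yes _ = X
... | no  _ = ∁ X

Equivalent : (G H : Graph) → V G → VSet G → V H → VSet H → Set
Equivalent G H x X y Y =
  (x ∈ X ⇔ y ∈ Y) × SameTypeWrt G H (partOf G x X) x (partOf H y Y) y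

data Round (G H : Graph) : Set where
  vtx : V G → V H → Round G H
  set : VSet G → VSet H → Round G H

Compatible : {G H : Graph} → Round G H → Round G H → Set
Compatible {G} {H} (vtx a b) (vtx c d) =
  (_∼_ {G} a c ⇔ _∼_ {H} b d) × ((a ≡ c) ⇔ (b ≡ d))
Compatible (vtx a b) (set A B) = (a ∈ A) ⇔ (b ∈ B)
Compatible (set A B) (vtx a b) = (a ∈ A) ⇔ (b ∈ B)
Compatible (set _ _) (set _ _) = ⊤

DupWinning : {G H : Graph} → List (Round G H) → Set
DupWinning rs = ∀ r s → r ∈ₗ rs → s ∈ₗ rs → Compatible r s

DupWinsLastRound : (G H : Graph) → List (Round G H) → Set
DupWinsLastRound G H rs =
  (∀ (x' : V G) → ∃ λ (y' : V H) → DupWinning (rs ++ vtx x' y' ∷ [])) ×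
  (∀ (y' : V H) → ∃ λ (x' : V G) → DupWinning (rs ++ vtx x' y' ∷ [])) ×
  (∀ (X' : VSet G) → ∃ λ (Y' : VSet H) → DupWinning (rs ++ set X' Y' ∷ [])) ×
  (∀ (Y' : VSet H) → ∃ λ (X' : VSet G) → DupWinning (rs ++ set X' Y' ∷ []))

firstTwo : {G H : Graph} → Bool → V G → VSet G → V H → VSet H → List (Round G H)
firstTwo true  x X y Y = vtx x y ∷ set X Y ∷ []
firstTwo false x X y Y = set X Y ∷ vtx x y ∷ []

module Submission where

-- After a vertex round (x , y) and a set round (X , Y) the only
-- constraints on the third round come from x, y, X and Y.  A set move X' is
-- answered by any Y' that contains y exactly when X' contains x.  A vertex
-- move x' has to be matched by a y' that is equal / adjacent to y exactly when
-- x' is equal / adjacent to x, and that lies in Y exactly when x' lies in X.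
--
-- Let Z be the part (X or its complement) containing x, and W the one
-- containing y.  For a region (inside Z or outside Z) and an adjacency bit,
-- call the set of vertices w ≠ x in that region with that adjacency to x a
-- "cell" of x.  The four type predicates each say exactly that one of the four
-- cells is empty, so x and y of the same type have the same non-empty cells;
-- hence any x' ≠ x has a partner y' ≠ y in the corresponding cell of y.

open import Defs
open import Data.Bool using (Bool; true; false; not)
open import Data.Bool.Properties using (not-injective; ¬-not) renaming (_≟_ to _≟ᵇ_)
open import Data.Fin using (Fin) renaming (_≟_ to _≟ᶠ_)
open import Data.Fin.Properties using (any?)
open import Data.Fin.Subset using (Subset; _∈_; _∉_; ∁)
import Data.Fin.Subset as Subset
open import Data.Fin.Subset.Properties using (_∈?_; x∉p⇒x∈∁p; ∈⊤; ∉⊥)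
open import Data.Vec using (lookup)
open import Data.Vec.Properties using ([]=⇒lookup; lookup⇒[]=; lookup-map)
open import Data.Product using (_×_; ∃; _,_)
open import Data.Unit using (tt)
open import Data.Empty using (⊥; ⊥-elim)
open import Data.List using (List; []; _∷_; _++_)
open import Data.List.Relation.Unary.All as All using (All; []; _∷_)
open import Data.List.Relation.Unary.Any using (here; there)
open import Function.Bundles using (_⇔_; mk⇔; Equivalence)
open import Function.Properties.Equivalence using () renaming (sym to ⇔-sym; trans to ⇔-trans)
open import Relation.Binary.PropositionalEquality using (_≡_; _≢_; refl; trans; module ≡-Reasoning) renaming (sym to ≡-sym)
open import Relation.Nullary using (¬_; yes; no; Dec)
open import Relation.Nullary.Decidable using (_×-dec_; ¬?; decidable-stable)

open Equivalence using (to; from)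

∼-irrefl : (G : Graph) (v : V G) → ¬ (_∼_ {G} v v)
∼-irrefl G v v∼v = conflict v∼v (irrefl G v)
  where
    conflict : {b : Bool} → b ≡ true → b ≡ false → ⊥
    conflict refl ()

∼-sym : (G : Graph) {u v : V G} → _∼_ {G} u v → _∼_ {G} v u
∼-sym G {u} {v} u∼v = trans (sym G v u) u∼v

adj-⇔ : (G H : Graph) {u v : V G} {u' v' : V H} →
  adj G u v ≡ adj H u' v' → (_∼_ {G} u v ⇔ _∼_ {H} u' v')
adj-⇔ G H e = mk⇔ (trans (≡-sym e)) (trans e)

lookup-⇔ : ∀ {m n} {p : Subset m} {q : Subset n} {i : Fin m} {j : Fin n} →
  lookup p i ≡ lookup q j → (i ∈ p ⇔ j ∈ q)
lookup-⇔ {p = p} {q} {i} {j} e =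
  mk⇔ (λ i∈p → lookup⇒[]= j q (trans (≡-sym e) ([]=⇒lookup i∈p)))
      (λ j∈q → lookup⇒[]= i p (trans e ([]=⇒lookup j∈q)))

∉⇒lookup≡false : ∀ {n} {p : Subset n} {i : Fin n} → i ∉ p → lookup p i ≡ false
∉⇒lookup≡false {p = p} {i} i∉p = ¬-not (λ e → i∉p (lookup⇒[]= i p e))

lookup≡false⇒∉ : ∀ {n} {p : Subset n} {i : Fin n} → lookup p i ≡ false → i ∉ p
lookup≡false⇒∉ e i∈p with trans (≡-sym e) ([]=⇒lookup i∈p)
... | ()

distinct-⇔ : {A B : Set} {a a' : A} {b b' : B} → a ≢ a' → b ≢ b' → (a ≡ a' ⇔ b ≡ b')
distinct-⇔ a≢a' b≢b' = mk⇔ (λ e → ⊥-elim (a≢a' e)) (λ e → ⊥-elim (b≢b' e))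

-- A set move can always be answered: choose everything or nothing.
answerSet : ∀ {m n} (i : Fin m) (j : Fin n) (p : Subset m) → ∃ λ q → (i ∈ p ⇔ j ∈ q)
answerSet i j p with i ∈? p
... | yes i∈p = Subset.⊤ , mk⇔ (λ _ → ∈⊤) (λ _ → i∈p)
... | no  i∉p = Subset.⊥ , mk⇔ (λ i∈p → ⊥-elim (i∉p i∈p)) (λ j∈⊥ → ⊥-elim (∉⊥ j∈⊥))

Cell : (G : Graph) → VSet G → V G → Bool → Bool → Set
Cell G Z v i a = ∃ λ w → w ≢ v × lookup Z w ≡ i × adj G v w ≡ a

cell? : (G : Graph) (Z : VSet G) (v : V G) (i a : Bool) → Dec (Cell G Z v i a)
cell? G Z v i a = any? λ w → ¬? (w ≟ᶠ v) ×-dec (lookup Z w ≟ᵇ i) ×-dec (adj G v w ≟ᵇ a)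

-- Each type predicate says that one particular cell is empty; for the two
-- outside predicates this uses that v itself lies in Z.

insideDominating⇔ : (G : Graph) (Z : VSet G) (v : V G) →
  InsideDominating G Z v ⇔ (¬ Cell G Z v true false)
insideDominating⇔ G Z v = mk⇔ empty dominating
  where
    empty : InsideDominating G Z v → ¬ Cell G Z v true false
    empty dom (w , w≢v , w∈Z , nonadj) with trans (≡-sym nonadj) (dom w (lookup⇒[]= w Z w∈Z) w≢v)
    ... | ()
    dominating : ¬ Cell G Z v true false → InsideDominating G Z v
    dominating none w w∈Z w≢v with adj G v w in e
    ... | true  = refl
    ... | false = ⊥-elim (none (w , w≢v , []=⇒lookup w∈Z , e))

insideIsolated⇔ : (G : Graph) (Z : VSet G) (v : V G) →
  InsideIsolated G Z v ⇔ (¬ Cell G Z v true true)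
insideIsolated⇔ G Z v = mk⇔ empty isolated
  where
    empty : InsideIsolated G Z v → ¬ Cell G Z v true true
    empty iso (w , _ , w∈Z , v∼w) = iso w (lookup⇒[]= w Z w∈Z) v∼w
    isolated : ¬ Cell G Z v true true → InsideIsolated G Z v
    isolated none w w∈Z v∼w = none (w , w≢v , []=⇒lookup w∈Z , v∼w)
      where
        w≢v : w ≢ v
        w≢v refl = ∼-irrefl G v v∼w

outsideDominating⇔ : (G : Graph) (Z : VSet G) (v : V G) → v ∈ Z →
  OutsideDominating G Z v ⇔ (¬ Cell G Z v false false)
outsideDominating⇔ G Z v v∈Z = mk⇔ empty dominating
  where
    empty : OutsideDominating G Z v → ¬ Cell G Z v false false
    empty dom (w , _ , w∉Z , nonadj) with trans (≡-sym nonadj) (dom w (lookup≡false⇒∉ w∉Z))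
    ... | ()
    dominating : ¬ Cell G Z v false false → OutsideDominating G Z v
    dominating none w w∉Z with adj G v w in e
    ... | true  = refl
    ... | false = ⊥-elim (none (w , w≢v , ∉⇒lookup≡false w∉Z , e))
      where
        w≢v : w ≢ v
        w≢v refl = w∉Z v∈Z

outsideIsolated⇔ : (G : Graph) (Z : VSet G) (v : V G) → v ∈ Z →
  OutsideIsolated G Z v ⇔ (¬ Cell G Z v false true)
outsideIsolated⇔ G Z v v∈Z = mk⇔ empty isolated
  where
    empty : OutsideIsolated G Z v → ¬ Cell G Z v false true
    empty iso (w , _ , w∉Z , v∼w) = iso w (lookup≡false⇒∉ w∉Z) v∼w
    isolated : ¬ Cell G Z v false true → OutsideIsolated G Z v
    isolated none w w∉Z v∼w = none (w , w≢v , ∉⇒lookup≡false w∉Z , v∼w)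
      where
        w≢v : w ≢ v
        w≢v refl = w∉Z v∈Z

dec-¬-⇔ : {A B : Set} → Dec A → Dec B → ((¬ A) ⇔ (¬ B)) → (A ⇔ B)
dec-¬-⇔ A? B? e =
  mk⇔ (λ a → decidable-stable B? (λ ¬b → from e ¬b a))
      (λ b → decidable-stable A? (λ ¬a → to e ¬a b))

sameType⇒sameCells : (G H : Graph) (Z : VSet G) (W : VSet H) (x : V G) (y : V H) →
  x ∈ Z → y ∈ W → SameTypeWrt G H Z x W y →
  (i a : Bool) → Cell G Z x i a ⇔ Cell H W y i a
sameType⇒sameCells G H Z W x y x∈Z y∈W (iD , iI , oD , oI) i a =
  dec-¬-⇔ (cell? G Z x i a) (cell? H W y i a) (emptiness i a)
  where
    transport : {P Q C D : Set} → P ⇔ (¬ C) → Q ⇔ (¬ D) → P ⇔ Q → (¬ C) ⇔ (¬ D)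
    transport P⇔ Q⇔ P⇔Q = ⇔-trans (⇔-sym P⇔) (⇔-trans P⇔Q Q⇔)
    emptiness : (i a : Bool) → (¬ Cell G Z x i a) ⇔ (¬ Cell H W y i a)
    emptiness true  false = transport (insideDominating⇔ G Z x) (insideDominating⇔ H W y) iD
    emptiness true  true  = transport (insideIsolated⇔ G Z x) (insideIsolated⇔ H W y) iI
    emptiness false false = transport (outsideDominating⇔ G Z x x∈Z) (outsideDominating⇔ H W y y∈W) oD
    emptiness false true  = transport (outsideIsolated⇔ G Z x x∈Z) (outsideIsolated⇔ H W y y∈W) oI

-- For x' = x take y' = y; otherwise x' lies in a cell of x and y' is taken
-- from the corresponding cell of y.
matchVertex : (G H : Graph) (Z : VSet G) (W : VSet H) (x : V G) (y : V H) →
  x ∈ Z → y ∈ W → SameTypeWrt G H Z x W y → (x' : V G) →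
  ∃ λ y' → adj G x x' ≡ adj H y y' × (x ≡ x' ⇔ y ≡ y') × lookup Z x' ≡ lookup W y'
matchVertex G H Z W x y x∈Z y∈W st x' with x' ≟ᶠ x
... | yes refl =
  y , trans (irrefl G x) (≡-sym (irrefl H y)) , mk⇔ (λ _ → refl) (λ _ → refl) ,
  trans ([]=⇒lookup x∈Z) (≡-sym ([]=⇒lookup y∈W))
... | no x'≢x
  with to (sameType⇒sameCells G H Z W x y x∈Z y∈W st (lookup Z x') (adj G x x'))
          (x' , x'≢x , refl , refl)
...   | y' , y'≢y , y'∈W , adjacency =
  y' , ≡-sym adjacency , distinct-⇔ (λ e → x'≢x (≡-sym e)) (λ e → y'≢y (≡-sym e)) , ≡-sym y'∈W

∈partOf : (G : Graph) (x : V G) (X : VSet G) → x ∈ partOf G x X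
∈partOf G x X with x ∈? X
... | yes x∈X = x∈X
... | no  x∉X = x∉p⇒x∈∁p x∉X

partOf-agreement : (G H : Graph) (x x' : V G) (X : VSet G) (y y' : V H) (Y : VSet H) →
  (x ∈ X ⇔ y ∈ Y) → lookup (partOf G x X) x' ≡ lookup (partOf H y Y) y' →
  lookup X x' ≡ lookup Y y'
partOf-agreement G H x x' X y y' Y x∈X⇔y∈Y e with x ∈? X | y ∈? Y
... | yes _   | yes _   = e
... | yes x∈X | no  y∉Y = ⊥-elim (y∉Y (to x∈X⇔y∈Y x∈X))
... | no  x∉X | yes y∈Y = ⊥-elim (x∉X (from x∈X⇔y∈Y y∈Y))
... | no  _   | no  _   = not-injective (begin
      not (lookup X x')    ≡⟨ ≡-sym (lookup-map x' not X) ⟩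
      lookup (∁ X) x'      ≡⟨ e ⟩
      lookup (∁ Y) y'      ≡⟨ lookup-map y' not Y ⟩
      not (lookup Y y')    ∎)
  where open ≡-Reasoning

Answers : (G H : Graph) → V G → VSet G → V H → VSet H → V G → V H → Set
Answers G H x X y Y x' y' =
  (_∼_ {G} x x' ⇔ _∼_ {H} y y') × (x ≡ x' ⇔ y ≡ y') × (x' ∈ X ⇔ y' ∈ Y)

answers-sym : (G H : Graph) {x x' : V G} {X : VSet G} {y y' : V H} {Y : VSet H} →
  Answers G H x X y Y x' y' → Answers H G y Y x X y' x'
answers-sym G H (a , e , m) = ⇔-sym a , ⇔-sym e , ⇔-sym m

equivalent-sym : (G H : Graph) {x : V G} {X : VSet G} {y : V H} {Y : VSet H} →
  Equivalent G H x X y Y → Equivalent H G y Y x X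
equivalent-sym G H (m , iD , iI , oD , oI) =
  ⇔-sym m , ⇔-sym iD , ⇔-sym iI , ⇔-sym oD , ⇔-sym oI

answerVertex : (G H : Graph) (x : V G) (X : VSet G) (y : V H) (Y : VSet H) →
  Equivalent G H x X y Y → (x' : V G) → ∃ (Answers G H x X y Y x')
answerVertex G H x X y Y (x∈X⇔y∈Y , st) x'
  with matchVertex G H (partOf G x X) (partOf H y Y) x y (∈partOf G x X) (∈partOf H y Y) st x'
... | y' , adjacency , equality , parts =
  y' , adj-⇔ G H adjacency , equality ,
  lookup-⇔ (partOf-agreement G H x x' X y y' Y x∈X⇔y∈Y parts)

compatible-refl : {G H : Graph} (r : Round G H) → Compatible r r
compatible-refl {G} {H} (vtx a b) =
  mk⇔ (λ a∼a → ⊥-elim (∼-irrefl G a a∼a)) (λ b∼b → ⊥-elim (∼-irrefl H b b∼b)) ,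
  mk⇔ (λ _ → refl) (λ _ → refl)
compatible-refl (set _ _) = tt

compatible-sym : {G H : Graph} (r s : Round G H) → Compatible r s → Compatible s r
compatible-sym {G} {H} (vtx a b) (vtx c d) (adjacent , equal) =
  mk⇔ (λ c∼a → ∼-sym H (to adjacent (∼-sym G c∼a))) (λ d∼b → ∼-sym G (from adjacent (∼-sym H d∼b))) ,
  mk⇔ (λ c≡a → ≡-sym (to equal (≡-sym c≡a))) (λ d≡b → ≡-sym (from equal (≡-sym d≡b)))
compatible-sym (vtx _ _) (set _ _) m = m
compatible-sym (set _ _) (vtx _ _) m = m
compatible-sym (set _ _) (set _ _) _ = tt

winning-[] : {G H : Graph} → DupWinning {G} {H} []
winning-[] _ _ ()

winning-∷ : {G H : Graph} {r : Round G H} {rs : List (Round G H)} →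
  All (Compatible r) rs → DupWinning rs → DupWinning (r ∷ rs)
winning-∷ {r = r} _ _ _ _ (here refl) (here refl) = compatible-refl r
winning-∷ compat _ _ _ (here refl) (there s∈) = All.lookup compat s∈
winning-∷ {r = r} compat _ t _ (there t∈) (here refl) = compatible-sym r t (All.lookup compat t∈)
winning-∷ _ win t s (there t∈) (there s∈) = win t s t∈ s∈

winningAfterTwo : {G H : Graph} (vertexFirst : Bool) {x : V G} {X : VSet G} {y : V H} {Y : VSet H}
  {r : Round G H} → Compatible {G} {H} (vtx x y) (set X Y) →
  Compatible (vtx x y) r → Compatible (set X Y) r →
  DupWinning (firstTwo vertexFirst x X y Y ++ r ∷ [])
winningAfterTwo true vs vr sr =
  winning-∷ (vs ∷ vr ∷ []) (winning-∷ (sr ∷ []) (winning-∷ {rs = []} [] winning-[]))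
winningAfterTwo {G} {H} false {x} {X} {y} {Y} vs vr sr =
  winning-∷ (compatible-sym {G} {H} (vtx x y) (set X Y) vs ∷ sr ∷ [])
    (winning-∷ (vr ∷ []) (winning-∷ {rs = []} [] winning-[]))

lemma8 : (G H : Graph) (vertexFirst : Bool) (x : V G) (X : VSet G) (y : V H) (Y : VSet H) →
    Equivalent G H x X y Y →
    DupWinsLastRound G H (firstTwo vertexFirst x X y Y)
lemma8 G H vertexFirst x X y Y equivalent@(x∈X⇔y∈Y , _) =
  (λ x' → let (y' , answer) = answerVertex G H x X y Y equivalent x'
          in y' , respond answer) ,
  (λ y' → let (x' , answer) = answerVertex H G y Y x X (equivalent-sym G H equivalent) y'
          in x' , respond (answers-sym H G answer)) ,
  (λ X' → let (Y' , m) = answerSet x y X' in Y' , winningAfterTwo vertexFirst x∈X⇔y∈Y m tt) ,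
  (λ Y' → let (X' , m) = answerSet y x Y' in X' , winningAfterTwo vertexFirst x∈X⇔y∈Y (⇔-sym m) tt)
  where
    respond : {x' : V G} {y' : V H} → Answers G H x X y Y x' y' →
      DupWinning (firstTwo vertexFirst x X y Y ++ vtx x' y' ∷ [])
    respond (adjacent , equal , member) =
      winningAfterTwo vertexFirst x∈X⇔y∈Y (adjacent , equal) member
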